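{- Let $k\ge1$, $c,r\ge1$ with $c+r=k+1$ and $R=(c^r)$. Then $$Y_R:=\sum_{\gamma\in\Gamma}{\bf u}(z_\gamma)\;=\;W_R:=\sum_{B}{\bf u}(j_B),$$ where $B$ ranges over all $c$-element subsets of $\{1,\dots,k+1\}$.
   Context: Indices are modulo $k+1$. $W$ is the affine symmetric group with generators $s_0,\dots,s_k$ (relations $s_i^2=1$, $s_is_j=s_js_i$ for $i-j\not\equiv\pm1$, $s_is_{i+1}s_i=s_{i+1}s_is_{i+1}$); $\mathbb{A}$ is the affine nilCoxeter algebra with generators $u_0,\dots,u_k$ (relations $u_i^2=0$ and the same commutation and braid relations); for $w\in W$ with reduced word $s_{i_1}\cdots s_{i_m}$, ${\bf u}(w)=u_{i_1}\cdots u_{i_m}$. Let $V=\mathbb{R}^{k+1}/\mathbb{R}(1,\dots,1)$ with $W$-action: for $i\ne0$, $s_i\diamond a$ swaps coordinates $i,i+1$; $s_0\diamond(a_1,\dots,a_{k+1})=(a_{k+1}+1,a_2,\dots,a_k,a_1-1)$. Weights are images of $\mathbb{Z}^{k+1}$; $A_\emptyset=\{a:a_1\ge\dots\ge a_{k+1}\ge a_1-1\}$, $A_w=w^{ -1}\diamond A_\emptyset$; for a weight $\gamma$, $z_\gamma$ is the unique element of $W$ with $A_{z_\gamma}=A_\emptyset+\gamma$. $\Gamma$ is the set of elements of $V$ represented by a $\{0,1\}$-vector with coordinate sum $c$. $W$ is identified with the group of bijections $w:\mathbb{Z}\to\mathbb{Z}$ with $w(i+k+1)=w(i)+k+1$ and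 $\sum_{i=1}^{k+1}w(i)=\binom{k+2}{2}$, composition of functions as product, where $s_i(j)=j+1$ if $j\equiv i$, $s_i(j)=j-1$ if $j\equiv i+1$, $s_i(j)=j$ otherwise (mod $k+1$). For a $c$-subset $B\subseteq\{1,\dots,k+1\}$, $j_B\in W$ is the element with $j_B(i)=i-r$ if $i\in B$ and $j_B(i)=i+c$ if $i\notin B$, for $1\le i\le k+1$. -}

module Defs where

open import Data.Nat as ℕ using (ℕ; zero; suc; _≡ᵇ_; _∸_)
open import Data.Integer as ℤ using (ℤ; +_; _/ℕ_; _%ℕ_)
open import Data.Integer.DivMod using (n%ℕd<d)
open import Data.Rational as ℚ using (ℚ; 0ℚ; 1ℚ)
open import Data.Fin as Fin using (Fin; toℕ; fromℕ; fromℕ<)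
open import Data.Fin.Subset using (Subset; Side; inside; outside; ∣_∣)
open import Data.Vec as Vec using (Vec; []; _∷_; tabulate; lookup)
open import Data.Vec.Properties using (≡-dec)
open import Data.List as List using (List; []; _∷_; _++_; filter; length; reverse; map; foldr)
open import Data.Bool using (Bool; true; false; if_then_else_)
open import Data.Product using (Σ; ∃; _×_; _,_)
open import Relation.Binary.PropositionalEquality using (_≡_)
open import Relation.Nullary using (Dec; yes; no)

-- Throughout, k is the parameter of the paper and n = k+1 = suc k.
-- A coordinate / residue i ∈ {1,…,n} is represented by p : Fin n with
-- i = toℕ p + 1.

-- The affine symmetric group W: bijections w : ℤ → ℤ with
-- w(i+n) = w(i)+n (and Σ_{i=1}^n w(i) = binom(n+1,2)), represented by
-- the window [w(1),…,w(n)], which determines w.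

Window : ℕ → Set
Window k = Vec ℤ (suc k)

-- Evaluate the periodic bijection with window v at an arbitrary integer j:
-- writing j - 1 = q n + r (0 ≤ r < n), w(j) = w(r+1) + q n.
evalW : ∀ k → Window k → ℤ → ℤ
evalW k v j =
  lookup v (fromℕ< (n%ℕd<d (j ℤ.- + 1) (suc k)))
  ℤ.+ ((j ℤ.- + 1) /ℕ suc k) ℤ.* + suc k

_·W_ : ∀ {k} → Window k → Window k → Window k
_·W_ {k} v w = tabulate (λ p → evalW k v (lookup w p))

idW : ∀ k → Window k
idW k = tabulate (λ p → + suc (toℕ p))

-- the generator s_i (i ∈ {0,…,k}):  s_i(j) = j+1 if j ≡ i, j-1 if j ≡ i+1,
-- j otherwise (mod n).  On the window j ∈ {1,…,n}:
genW : ∀ k → Fin (suc k) → Window k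
genW k i = tabulate λ p →
  let j = suc (toℕ p) ; ii = toℕ i in
  if ii ≡ᵇ 0
    then (if j ≡ᵇ suc k then + suc j else if j ≡ᵇ 1 then + 0 else + j)
    else (if j ≡ᵇ ii then + suc j else if j ≡ᵇ suc ii then + ii else + j)

wordW : ∀ k → List (Fin (suc k)) → Window k
wordW k = foldr (λ i w → genW k i ·W w) (idW k)

-- The space V = ℝ^{n} / ℝ(1,…,1): points are represented by vectors
-- (here with rational coordinates) up to adding a constant.

Point : ℕ → Set
Point k = Fin (suc k) → ℚ

_≈V_ : ∀ {k} → Point k → Point k → Set
x ≈V y = ∃ λ (t : ℚ) → ∀ p → x p ≡ y p ℚ.+ t

-- 1-based coordinate access a_j (j ∈ {1,…,n}; junk value 0 outside)
coord : ∀ {k} → Point k → ℕ → ℚ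
coord {k} a zero = 0ℚ
coord {k} a (suc m) with m ℕ.<? suc k
... | yes h = a (fromℕ< h)
... | no _  = 0ℚ

genAct : ∀ k → Fin (suc k) → Point k → Point k
genAct k i a p =
  let j = suc (toℕ p) ; ii = toℕ i in
  if ii ≡ᵇ 0
    then (if j ≡ᵇ 1 then coord a (suc k) ℚ.+ 1ℚ
          else if j ≡ᵇ suc k then coord a 1 ℚ.- 1ℚ
          else a p)
    else (if j ≡ᵇ ii then coord a (suc ii)
          else if j ≡ᵇ suc ii then coord a ii
          else a p)

wordAct : ∀ k → List (Fin (suc k)) → Point k → Point k
wordAct k ws a = foldr (genAct k) a ws

InA∅ : ∀ k → Point k → Set
InA∅ k a =
  (∀ (m : ℕ) → m ℕ.< k → coord a (suc (suc m)) ℚ.≤ coord a (suc m))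
  × (coord a 1 ℚ.- 1ℚ ℚ.≤ coord a (suc k))

-- A_w = w⁻¹ ◇ A_∅ (as a subset of V).  If w = s_{i_1}⋯s_{i_m} then
-- w⁻¹ = s_{i_m}⋯s_{i_1}, i.e. the reversed word.
InAlcove : ∀ k → Window k → Point k → Set
InAlcove k w x =
  ∃ λ (ws : List (Fin (suc k))) → wordW k ws ≡ w ×
    ∃ λ (a : Point k) → InA∅ k a × x ≈V wordAct k (reverse ws) a

InShifted : ∀ k → Point k → Point k → Set
InShifted k γ x = ∃ λ (a : Point k) → InA∅ k a × x ≈V (λ p → a p ℚ.+ γ p)

AlcoveIsShift : ∀ k → Window k → Point k → Set
AlcoveIsShift k w γ =
  ∀ (x : Point k) → (InAlcove k w x → InShifted k γ x) × (InShifted k γ x → InAlcove k w x)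

allSubsets : ∀ m → List (Subset m)
allSubsets zero = [] ∷ []
allSubsets (suc m) = map (inside ∷_) (allSubsets m) ++ map (outside ∷_) (allSubsets m)

subsetsOfSize : ∀ m → ℕ → List (Subset m)
subsetsOfSize m c = filter (λ B → ∣ B ∣ ℕ.≟ c) (allSubsets m)

indicator : ∀ {k} → Subset (suc k) → Point k
indicator γ p = if lookup γ p then 1ℚ else 0ℚ

jB : ∀ k (c r : ℕ) → Subset (suc k) → Window k
jB k c r B = tabulate λ p →
  if lookup B p then + suc (toℕ p) ℤ.- + r else + (suc (toℕ p) ℕ.+ c)

-- The affine nilCoxeter algebra 𝔸 is the free module with basis
-- {u(w) : w ∈ W}.  A sum Σ u(w_ℓ) of basis elements (w_ℓ ∈ W) is encoded
-- by the list of the w_ℓ; its coefficient at u(w) is: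

_≟W_ : ∀ {k} → (v w : Window k) → Dec (v ≡ w)
_≟W_ = ≡-dec ℤ._≟_

coeff : ∀ {k} → List (Window k) → Window k → ℕ
coeff ws w = length (filter (_≟W w) ws)

_≡𝔸_ : ∀ {k} → List (Window k) → List (Window k) → Set
_≡𝔸_ {k} xs ys = ∀ (w : Window k) → coeff xs w ≡ coeff ys w

-- Y_R = Σ_{γ∈Γ} u(z_γ), given the map γ ↦ z_γ (γ ∈ Γ ↔ c-subsets)
Y_R : ∀ k (c : ℕ) → (Subset (suc k) → Window k) → List (Window k)
Y_R k c z = map z (subsetsOfSize (suc k) c)

W_R : ∀ k (c r : ℕ) → List (Window k)
W_R k c r = map (jB k c r) (subsetsOfSize (suc k) c)

module Submission where

-- Fix γ and write w = z_γ and n = k + 1.  The point x = p + γ with p_j = -j/n (0-based j)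
-- lies in the interior of A_∅ + γ, so by hypothesis x = w⁻¹ ◇ a + t with a ∈ A_∅.
-- Writing w(j + 1) = 1 + σ(j) + n q(j) with 0 ≤ σ(j) < n, the inverse acts by reading
-- the window: (w⁻¹ ◇ a)_j = a_{σ(j)} - q(j).  Hence the integers N_j = n(γ_j + q_j) - j
-- equal n(a_{σ(j)} + t), so they are ordered opposite to σ and lie in a window of width n;
-- and Σ q = 0 because the action preserves coordinate sums.  These constraints force
-- γ_j + q_j = [r ≤ j] and σ(j) = (j + c) mod n, which is exactly the window of j_γ.

open import Defs
open import Data.Nat using (ℕ; suc; _≤_; _+_)
open import Data.Fin.Subset using (Subset; ∣_∣)
open import Relation.Binary.PropositionalEquality using (_≡_)

open import Algebra.Bundles using (CommutativeMonoid)
import Algebra.Properties.CommutativeMonoid.Sum as Sum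
open import Data.Bool using (true; false; T; if_then_else_)
open import Data.Empty using (⊥-elim)
open import Data.Fin as Fin using (Fin; zero; suc; toℕ; fromℕ; fromℕ<; inject₁)
import Data.Fin.Properties as FinP
open import Data.Integer as ℤ using (ℤ; +_; -[1+_]; +<+; +≤+; -<-; 0ℤ; 1ℤ; -1ℤ; _/ℕ_)
open import Data.Integer.DivMod using (n%ℕd<d; a≡a%ℕn+[a/ℕn]*n)
import Data.Integer.Properties as ℤP
open import Data.Integer.Tactic.RingSolver using (solve-∀)
open import Data.List using (List; []; _∷_; reverse)
import Data.List.Properties as ListP
import Data.List.Relation.Unary.All as All
import Data.List.Relation.Unary.All.Properties as AllP
open import Data.Nat as ℕ using (zero; s≤s; z≤n; _∸_; _≡ᵇ_)
import Data.Nat.Properties as ℕP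
open import Data.Product using (∃₂; _×_; _,_; proj₁; proj₂)
open import Data.Rational as ℚ using (ℚ; 0ℚ; 1ℚ; fromℚᵘ; toℚᵘ)
import Data.Rational.Properties as ℚP
open import Data.Rational.Solver using (module +-*-Solver)
open import Data.Rational.Unnormalised as ℚᵘ using (mkℚᵘ; *≡*; *≤*)
import Data.Rational.Unnormalised.Properties as ℚᵘP
open import Data.Sum using (_⊎_; inj₁; inj₂)
open import Data.Unit using (tt)
open import Data.Vec using ([]; _∷_; lookup)
import Data.Vec.Properties as VecP
open import Data.Vec.Functional using (Vector)
open import Function using (_∘_)
open import Relation.Binary.PropositionalEquality
  using (_≢_; refl; sym; trans; cong; cong₂; cong-app; subst; subst₂; module ≡-Reasoning)
open import Relation.Nullary using (yes; no)

-1<i<1⇒i≡0 : ∀ {i} → -1ℤ ℤ.< i → i ℤ.< 1ℤ → i ≡ 0ℤ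
-1<i<1⇒i≡0 {+ zero}       _        _              = refl
-1<i<1⇒i≡0 {+ suc _}      _        (+<+ (s≤s ()))
-1<i<1⇒i≡0 { -[1+ zero ]} (-<- ()) _
-1<i<1⇒i≡0 { -[1+ suc _ ]} (-<- ()) _

0≤i≤1⇒i≡0⊎i≡1 : ∀ {i} → 0ℤ ℤ.≤ i → i ℤ.≤ 1ℤ → i ≡ 0ℤ ⊎ i ≡ 1ℤ
0≤i≤1⇒i≡0⊎i≡1 {+ zero}       _ _                       = inj₁ refl
0≤i≤1⇒i≡0⊎i≡1 {+ suc zero}   _ _                       = inj₂ refl
0≤i≤1⇒i≡0⊎i≡1 {+ suc (suc _)} _ (ℤ.+≤+ (s≤s ()))

divMod-unique : ∀ n {ρ ρ′} (q q′ : ℤ) → ρ ℕ.< n → ρ′ ℕ.< n →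
                + ρ ℤ.+ q ℤ.* + n ≡ + ρ′ ℤ.+ q′ ℤ.* + n → q ≡ q′ × ρ ≡ ρ′
divMod-unique n {ρ} {ρ′} q q′ ρ<n ρ′<n eq =
  ℤP.i-j≡0⇒i≡j q q′ d≡0 , ℤP.+-injective (sym (ℤP.i-j≡0⇒i≡j (+ ρ′) (+ ρ) ρ′-ρ≡0))
  where
  d : ℤ
  d = q ℤ.- q′
  difference : ∀ a b b′ m → (b ℤ.- b′) ℤ.* m ≡ (a ℤ.+ b ℤ.* m) ℤ.- (a ℤ.+ b′ ℤ.* m)
  difference = solve-∀
  cancel : ∀ a a′ b m → (a′ ℤ.+ b ℤ.* m) ℤ.- (a ℤ.+ b ℤ.* m) ≡ a′ ℤ.- a
  cancel = solve-∀
  d*n≡ρ′-ρ : d ℤ.* + n ≡ + ρ′ ℤ.- + ρ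
  d*n≡ρ′-ρ = begin
    d ℤ.* + n                                      ≡⟨ difference (+ ρ) q q′ (+ n) ⟩
    (+ ρ ℤ.+ q ℤ.* + n) ℤ.- (+ ρ ℤ.+ q′ ℤ.* + n)   ≡⟨ cong (ℤ._- (+ ρ ℤ.+ q′ ℤ.* + n)) eq ⟩
    (+ ρ′ ℤ.+ q′ ℤ.* + n) ℤ.- (+ ρ ℤ.+ q′ ℤ.* + n) ≡⟨ cancel (+ ρ) (+ ρ′) q′ (+ n) ⟩
    + ρ′ ℤ.- + ρ                                   ∎
    where open ≡-Reasoning
  upper : d ℤ.* + n ℤ.< 1ℤ ℤ.* + n
  upper = subst₂ ℤ._<_ (sym d*n≡ρ′-ρ) (sym (ℤP.*-identityˡ (+ n)))
            (ℤP.≤-<-trans (ℤP.i-j≤i (+ ρ′) (+ ρ)) (+<+ ρ′<n))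
  lower : -1ℤ ℤ.* + n ℤ.< d ℤ.* + n
  lower = subst₂ ℤ._<_ (sym (ℤP.-1*i≡-i (+ n))) (sym d*n≡ρ′-ρ)
            (ℤP.<-≤-trans (ℤP.neg-mono-< (+<+ ρ<n)) (ℤP.i≤j+i (ℤ.- + ρ) (+ ρ′)))
  d≡0 : d ≡ 0ℤ
  d≡0 = -1<i<1⇒i≡0 (ℤP.*-cancelʳ-<-nonNeg (+ n) lower) (ℤP.*-cancelʳ-<-nonNeg (+ n) upper)
  ρ′-ρ≡0 : + ρ′ ℤ.- + ρ ≡ 0ℤ
  ρ′-ρ≡0 = trans (sym d*n≡ρ′-ρ) (trans (cong (ℤ._* + n) d≡0) (ℤP.*-zeroˡ (+ n)))

i<j+1⇒i≤j : ∀ {i j} → i ℤ.< j ℤ.+ 1ℤ → i ℤ.≤ j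
i<j+1⇒i≤j {i} {j} i<j+1 = subst (i ℤ.≤_) (pred-suc j) (ℤP.i<j⇒i≤pred[j] i<j+1)
  where
  pred-suc : ∀ j → -1ℤ ℤ.+ (j ℤ.+ 1ℤ) ≡ j
  pred-suc = solve-∀

module _ {a ℓ} (M : CommutativeMonoid a ℓ) where
  open CommutativeMonoid M
    using (Carrier; _≈_; _∙_; ε; setoid; ∙-cong; ∙-congˡ; identityˡ; identityʳ; comm)
    renaming (trans to ≈-trans)
  open import Algebra.Properties.CommutativeMonoid.Sum M using (sum; sum-cong-≋; sum-replicate-zero)
  open import Relation.Binary.Reasoning.Setoid setoid

  sum-vanishing : ∀ {n} (t : Vector Carrier n) → (∀ p → t p ≈ ε) → sum t ≈ ε
  sum-vanishing {n} t t≈0 = ≈-trans (sum-cong-≋ t≈0) (sum-replicate-zero n)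

  sum-supported-at : ∀ {n} (t : Vector Carrier n) v → (∀ p → p ≢ v → t p ≈ ε) → sum t ≈ t v
  sum-supported-at t zero    t≈0 = begin
    t zero ∙ sum (t ∘ suc) ≈⟨ ∙-congˡ (sum-vanishing (t ∘ suc) (λ p → t≈0 (suc p) λ ())) ⟩
    t zero ∙ ε             ≈⟨ identityʳ (t zero) ⟩
    t zero                 ∎
  sum-supported-at t (suc v) t≈0 = begin
    t zero ∙ sum (t ∘ suc) ≈⟨ ∙-cong (t≈0 zero λ ()) (sum-supported-at (t ∘ suc) v λ p p≢v → t≈0 (suc p) (p≢v ∘ FinP.suc-injective)) ⟩
    ε ∙ t (suc v)          ≈⟨ identityˡ (t (suc v)) ⟩
    t (suc v)              ∎

  sum-supported-at-two : ∀ {n} (t : Vector Carrier n) u v → u ≢ v →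
                         (∀ p → p ≢ u → p ≢ v → t p ≈ ε) → sum t ≈ t u ∙ t v
  sum-supported-at-two t zero    zero    u≢v _   = ⊥-elim (u≢v refl)
  sum-supported-at-two t zero    (suc v) _   t≈0 =
    ∙-congˡ (sum-supported-at (t ∘ suc) v λ p p≢v → t≈0 (suc p) (λ ()) (p≢v ∘ FinP.suc-injective))
  sum-supported-at-two t (suc u) zero    _   t≈0 = begin
    t zero ∙ sum (t ∘ suc) ≈⟨ ∙-congˡ (sum-supported-at (t ∘ suc) u λ p p≢u → t≈0 (suc p) (p≢u ∘ FinP.suc-injective) (λ ())) ⟩
    t zero ∙ t (suc u)     ≈⟨ comm (t zero) (t (suc u)) ⟩
    t (suc u) ∙ t zero     ∎
  sum-supported-at-two t (suc u) (suc v) u≢v t≈0 = begin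
    t zero ∙ sum (t ∘ suc)      ≈⟨ ∙-cong (t≈0 zero (λ ()) (λ ()))
                                     (sum-supported-at-two (t ∘ suc) u v (u≢v ∘ cong suc)
                                       λ p p≢u p≢v → t≈0 (suc p) (p≢u ∘ FinP.suc-injective) (p≢v ∘ FinP.suc-injective)) ⟩
    ε ∙ (t (suc u) ∙ t (suc v)) ≈⟨ identityˡ _ ⟩
    t (suc u) ∙ t (suc v)       ∎

module ℚΣ = Sum ℚP.+-0-commutativeMonoid
module ℤΣ = Sum ℤP.+-0-commutativeMonoid

sum-mono-≤ : ∀ {n} {f g : Fin n → ℤ} → (∀ j → f j ℤ.≤ g j) → ℤΣ.sum f ℤ.≤ ℤΣ.sum g
sum-mono-≤ {zero}  f≤g = ℤP.≤-refl
sum-mono-≤ {suc n} f≤g = ℤP.+-mono-≤ (f≤g zero) (sum-mono-≤ (f≤g ∘ suc))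

sum-const : ∀ n x → ℤΣ.sum {n} (λ _ → x) ≡ + n ℤ.* x
sum-const zero    x = sym (ℤP.*-zeroˡ x)
sum-const (suc n) x = trans (cong (λ s → x ℤ.+ s) (sum-const n x)) (distribute x (+ n))
  where
  distribute : ∀ x m → x ℤ.+ m ℤ.* x ≡ (1ℤ ℤ.+ m) ℤ.* x
  distribute = solve-∀

sum-const-≤ : ∀ {n} {f : Fin n → ℤ} {x} → (∀ j → f j ℤ.≤ x) → ℤΣ.sum f ℤ.≤ + n ℤ.* x
sum-const-≤ {n} {x = x} f≤x = ℤP.≤-trans (sum-mono-≤ f≤x) (ℤP.≤-reflexive (sum-const n x))

const-≤-sum : ∀ {n} {f : Fin n → ℤ} {x} → (∀ j → x ℤ.≤ f j) → + n ℤ.* x ℤ.≤ ℤΣ.sum f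
const-≤-sum {n} {x = x} x≤f = ℤP.≤-trans (ℤP.≤-reflexive (sym (sum-const n x))) (sum-mono-≤ x≤f)

Monotone : ∀ {n} → (Fin n → ℤ) → Set
Monotone m = ∀ {i j} → i Fin.≤ j → m i ℤ.≤ m j

monotone-binary⇒step : ∀ {n} c r → c ℕ.+ r ≡ n → (m : Fin n → ℤ) →
  (∀ j → m j ≡ 0ℤ ⊎ m j ≡ 1ℤ) → Monotone m → ℤΣ.sum m ≡ + c →
  ∀ j → (r ℕ.≤ toℕ j → m j ≡ 1ℤ) × (toℕ j ℕ.< r → m j ≡ 0ℤ)
monotone-binary⇒step {suc n} c r c+r≡n m binary mono sum≡c j with binary zero
... | inj₂ m₀≡1 = (λ _ → all-one j) , λ j<r → ⊥-elim (ℕP.n≮0 (subst (toℕ j ℕ.<_) r≡0 j<r))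
  where
  all-one : ∀ j → m j ≡ 1ℤ
  all-one j with binary j
  ... | inj₁ mⱼ≡0 = ⊥-elim (ℤP.<⇒≱ (ℤ.+<+ (s≤s z≤n))
                      (subst₂ ℤ._≤_ m₀≡1 mⱼ≡0 (mono {zero} {j} z≤n)))
  ... | inj₂ mⱼ≡1 = mⱼ≡1
  c≡1+n : c ≡ suc n
  c≡1+n = ℤP.+-injective (begin
    + c                         ≡⟨ sum≡c ⟨
    ℤΣ.sum m                    ≡⟨ ℤΣ.sum-cong-≗ all-one ⟩
    ℤΣ.sum {suc n} (λ _ → 1ℤ)   ≡⟨ sum-const (suc n) 1ℤ ⟩
    + suc n ℤ.* 1ℤ              ≡⟨ ℤP.*-identityʳ (+ suc n) ⟩
    + suc n                     ∎)
    where open ≡-Reasoning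
  r≡0 : r ≡ 0
  r≡0 = ℕP.+-cancelˡ-≡ c r 0 (trans c+r≡n (trans (sym c≡1+n) (sym (ℕP.+-identityʳ c))))
monotone-binary⇒step {suc n} c zero c+0≡n m binary mono sum≡c j | inj₁ m₀≡0 =
  ⊥-elim (ℤP.<⇒≱ (ℤ.+<+ (ℕP.n<1+n n)) (ℤP.≤-trans (ℤP.≤-reflexive (sym (cong +_ c≡1+n))) c≤n))
  where
  c≡1+n : c ≡ suc n
  c≡1+n = trans (sym (ℕP.+-identityʳ c)) c+0≡n
  c≤n : + c ℤ.≤ + n
  c≤n = begin
    + c                        ≡⟨ sum≡c ⟨
    m zero ℤ.+ ℤΣ.sum (m ∘ suc) ≡⟨ cong (ℤ._+ ℤΣ.sum (m ∘ suc)) m₀≡0 ⟩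
    0ℤ ℤ.+ ℤΣ.sum (m ∘ suc)     ≡⟨ ℤP.+-identityˡ _ ⟩
    ℤΣ.sum (m ∘ suc)           ≤⟨ sum-const-≤ (λ j → at-most-one (binary (suc j))) ⟩
    + n ℤ.* 1ℤ                 ≡⟨ ℤP.*-identityʳ (+ n) ⟩
    + n                        ∎
    where
    open ℤP.≤-Reasoning
    at-most-one : ∀ {x} → x ≡ 0ℤ ⊎ x ≡ 1ℤ → x ℤ.≤ 1ℤ
    at-most-one (inj₁ refl) = ℤ.+≤+ z≤n
    at-most-one (inj₂ refl) = ℤP.≤-refl
monotone-binary⇒step {suc n} c (suc r) c+r≡n m binary mono sum≡c zero    | inj₁ m₀≡0 = (λ ()) , λ _ → m₀≡0
monotone-binary⇒step {suc n} c (suc r) c+r≡n m binary mono sum≡c (suc j) | inj₁ m₀≡0 =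
  (λ r≤j → ≥r (ℕ.s≤s⁻¹ r≤j)) , λ j<r → <r (ℕ.s≤s⁻¹ j<r)
  where
  tail-sum : ℤΣ.sum (m ∘ suc) ≡ + c
  tail-sum = trans (sym (trans (cong (ℤ._+ ℤΣ.sum (m ∘ suc)) m₀≡0) (ℤP.+-identityˡ _))) sum≡c
  tail : (r ℕ.≤ toℕ j → m (suc j) ≡ 1ℤ) × (toℕ j ℕ.< r → m (suc j) ≡ 0ℤ)
  tail = monotone-binary⇒step c r (ℕP.suc-injective (trans (sym (ℕP.+-suc c r)) c+r≡n))
           (m ∘ suc) (binary ∘ suc) (λ i≤j → mono (s≤s i≤j)) tail-sum j
  ≥r : r ℕ.≤ toℕ j → m (suc j) ≡ 1ℤ
  ≥r = proj₁ tail
  <r : toℕ j ℕ.< r → m (suc j) ≡ 0ℤ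
  <r = proj₂ tail

strictly-increasing⇒id : ∀ n (f : ℕ → ℕ) → (∀ {i} → i ℕ.< n → f i ℕ.< n) →
  (∀ {i j} → i ℕ.< j → j ℕ.< n → f i ℕ.< f j) → ∀ {i} → i ℕ.< n → f i ≡ i
strictly-increasing⇒id n f bounded increasing {i} i<n = ℕP.≤-antisym (at-most i<n) (at-least i i<n)
  where
  at-least : ∀ i → i ℕ.< n → i ℕ.≤ f i
  at-least zero    _     = z≤n
  at-least (suc i) 1+i<n =
    ℕP.<-≤-trans (s≤s (at-least i (ℕP.<-trans (ℕP.n<1+n i) 1+i<n))) (increasing (ℕP.n<1+n i) 1+i<n)
  room : ∀ d {i} → i ℕ.+ d ℕ.< n → f i ℕ.+ d ℕ.< n
  room zero    {i} i+0<n = subst (ℕ._< n) (sym (ℕP.+-identityʳ (f i))) (bounded (subst (ℕ._< n) (ℕP.+-identityʳ i) i+0<n))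
  room (suc d) {i} i+1+d<n = ℕP.≤-<-trans
    (subst (ℕ._≤ f (suc i) ℕ.+ d) (sym (ℕP.+-suc (f i) d)) (ℕP.+-monoˡ-≤ d (increasing (ℕP.n<1+n i) 1+i<n)))
    (room d (subst (ℕ._< n) (ℕP.+-suc i d) i+1+d<n))
    where
    1+i<n : suc i ℕ.< n
    1+i<n = ℕP.≤-<-trans (s≤s (ℕP.m≤m+n i d)) (subst (ℕ._< n) (ℕP.+-suc i d) i+1+d<n)
  at-most : ∀ {i} → i ℕ.< n → f i ℕ.≤ i
  at-most {i} i<n = ℕP.+-cancelʳ-≤ (n ∸ suc i) (f i) i (ℕP.≤-pred (subst (f i ℕ.+ (n ∸ suc i) ℕ.<_) (sym fills) (room (n ∸ suc i) i+d<n)))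
    where
    fills : suc (i ℕ.+ (n ∸ suc i)) ≡ n
    fills = ℕP.m+[n∸m]≡n i<n
    i+d<n : i ℕ.+ (n ∸ suc i) ℕ.< n
    i+d<n = subst (i ℕ.+ (n ∸ suc i) ℕ.<_) fills (ℕP.n<1+n _)

-- Rigidity of the ordering and width constraints

module Rigidity (K c r : ℕ) (c+r≡n : c ℕ.+ r ≡ suc K) (r≥1 : 1 ℕ.≤ r)
                (m : Fin (suc K) → ℤ) (σ : Fin (suc K) → Fin (suc K)) where

  n : ℕ
  n = suc K

  N : Fin n → ℤ
  N j = + n ℤ.* m j ℤ.- + toℕ j

  -- junk value zero for x ≥ n
  position : ℕ → Fin n
  position x with x ℕ.<? n
  ... | yes x<n = fromℕ< x<n
  ... | no  _   = zero

  toℕ-position : ∀ {x} → x ℕ.< n → toℕ (position x) ≡ x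
  toℕ-position {x} x<n with x ℕ.<? n
  ... | yes _   = FinP.toℕ-fromℕ< _
  ... | no  x≮n = ⊥-elim (x≮n x<n)

  position-toℕ : ∀ j → position (toℕ j) ≡ j
  position-toℕ j with toℕ j ℕ.<? n
  ... | yes j<n = FinP.fromℕ<-toℕ j j<n
  ... | no  j≮n = ⊥-elim (j≮n (FinP.toℕ<n j))

  -- inverse of the rotation j ↦ (j + c) mod n of {0, …, n - 1}
  unrank : ℕ → ℕ
  unrank i with i ℕ.<? c
  ... | yes _ = i ℕ.+ r
  ... | no  _ = i ∸ c

  unrank-upper : ∀ (j : Fin n) → r ℕ.≤ toℕ j → unrank (toℕ j ∸ r) ≡ toℕ j
  unrank-upper j r≤j with toℕ j ∸ r ℕ.<? c
  ... | yes _   = ℕP.m∸n+n≡m r≤j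
  ... | no  j≮c = ⊥-elim (j≮c (ℕP.+-cancelʳ-< r _ c
                    (subst₂ ℕ._<_ (sym (ℕP.m∸n+n≡m r≤j)) (sym c+r≡n) (FinP.toℕ<n j))))

  unrank-lower : ∀ (j : Fin n) → toℕ j ℕ.< r → unrank (toℕ j ℕ.+ c) ≡ toℕ j
  unrank-lower j j<r with toℕ j ℕ.+ c ℕ.<? c
  ... | yes j+c<c = ⊥-elim (ℕP.<⇒≱ j+c<c (ℕP.m≤n+m c (toℕ j)))
  ... | no  _     = ℕP.m+n∸n≡m (toℕ j) c

  module _ (sum≡c : ℤΣ.sum m ≡ + c)
           (reversed : ∀ j j′ → σ j Fin.≤ σ j′ → N j′ ℤ.≤ N j)
           (narrow : ∀ j j′ → N j ℤ.≤ N j′ ℤ.+ + n) where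

    private
      unscale : ∀ {x y} → + n ℤ.* x ℤ.< + n ℤ.* (y ℤ.+ 1ℤ) → x ℤ.≤ y
      unscale = i<j+1⇒i≤j ∘ ℤP.*-cancelˡ-<-nonNeg (+ n)
      split : ∀ a b → a ≡ (a ℤ.- b) ℤ.+ b
      split = solve-∀

    increasing : ∀ {i j} → toℕ i ℕ.< toℕ j → m i ℤ.≤ m j
    increasing {i} {j} i<j = unscale (begin-strict
      + n ℤ.* m i                ≡⟨ split (+ n ℤ.* m i) (+ toℕ i) ⟩
      N i ℤ.+ + toℕ i            ≤⟨ ℤP.+-monoˡ-≤ (+ toℕ i) (narrow i j) ⟩
      (N j ℤ.+ + n) ℤ.+ + toℕ i  <⟨ ℤP.+-monoʳ-< (N j ℤ.+ + n) (+<+ i<j) ⟩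
      (N j ℤ.+ + n) ℤ.+ + toℕ j  ≡⟨ regroup (+ n) (m j) (+ toℕ j) ⟩
      + n ℤ.* (m j ℤ.+ 1ℤ)       ∎)
      where
      open ℤP.≤-Reasoning
      regroup : ∀ a x b → ((a ℤ.* x ℤ.- b) ℤ.+ a) ℤ.+ b ≡ a ℤ.* (x ℤ.+ 1ℤ)
      regroup = solve-∀

    monotone : Monotone m
    monotone {i} {j} i≤j with ℕP.m≤n⇒m<n∨m≡n i≤j
    ... | inj₁ i<j = increasing i<j
    ... | inj₂ i≡j = ℤP.≤-reflexive (cong m (FinP.toℕ-injective i≡j))

    spread : ∀ i j → m j ℤ.≤ m i ℤ.+ 1ℤ
    spread i j = unscale (begin-strict
      + n ℤ.* m j                          ≡⟨ split (+ n ℤ.* m j) (+ toℕ j) ⟩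
      N j ℤ.+ + toℕ j                      ≤⟨ ℤP.+-monoˡ-≤ (+ toℕ j) (narrow j i) ⟩
      (N i ℤ.+ + n) ℤ.+ + toℕ j            <⟨ ℤP.+-monoʳ-< (N i ℤ.+ + n) j<i+n ⟩
      (N i ℤ.+ + n) ℤ.+ (+ toℕ i ℤ.+ + n)  ≡⟨ regroup (+ n) (m i) (+ toℕ i) ⟩
      + n ℤ.* ((m i ℤ.+ 1ℤ) ℤ.+ 1ℤ)        ∎)
      where
      open ℤP.≤-Reasoning
      j<i+n : + toℕ j ℤ.< + toℕ i ℤ.+ + n
      j<i+n = ℤP.<-≤-trans (+<+ (FinP.toℕ<n j)) (ℤP.i≤j+i (+ n) (+ toℕ i))
      regroup : ∀ a x b → ((a ℤ.* x ℤ.- b) ℤ.+ a) ℤ.+ (b ℤ.+ a) ≡ a ℤ.* ((x ℤ.+ 1ℤ) ℤ.+ 1ℤ)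
      regroup = solve-∀

    lowest : ∀ j → m zero ℤ.≤ m j
    lowest j = monotone {zero} {j} z≤n

    first≡0 : m zero ≡ 0ℤ
    first≡0 = -1<i<1⇒i≡0 (ℤP.*-cancelˡ-<-nonNeg (+ n) above) (ℤP.*-cancelˡ-<-nonNeg (+ n) below)
      where
      open ℤP.≤-Reasoning
      c<n : c ℕ.< n
      c<n = subst (c ℕ.<_) c+r≡n (subst (ℕ._≤ c ℕ.+ r) (ℕP.+-comm c 1) (ℕP.+-monoʳ-≤ c r≥1))
      below : + n ℤ.* m zero ℤ.< + n ℤ.* 1ℤ
      below = begin-strict
        + n ℤ.* m zero  ≤⟨ const-≤-sum lowest ⟩
        ℤΣ.sum m        ≡⟨ sum≡c ⟩
        + c             <⟨ +<+ c<n ⟩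
        + n             ≡⟨ ℤP.*-identityʳ (+ n) ⟨
        + n ℤ.* 1ℤ      ∎
      rearrange₁ : ∀ k → (1ℤ ℤ.+ k) ℤ.* -1ℤ ≡ (0ℤ ℤ.- k) ℤ.+ -1ℤ
      rearrange₁ = solve-∀
      rearrange₂ : ∀ k x → (x ℤ.+ k ℤ.* (x ℤ.+ 1ℤ)) ℤ.- k ≡ (1ℤ ℤ.+ k) ℤ.* x
      rearrange₂ = solve-∀
      above : + n ℤ.* -1ℤ ℤ.< + n ℤ.* m zero
      above = begin-strict
        + n ℤ.* -1ℤ                                       ≡⟨ cong (ℤ._* -1ℤ) (ℤP.pos-+ 1 K) ⟩
        (1ℤ ℤ.+ + K) ℤ.* -1ℤ                              ≡⟨ rearrange₁ (+ K) ⟩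
        (0ℤ ℤ.- + K) ℤ.+ -1ℤ                              <⟨ ℤP.+-monoʳ-< (0ℤ ℤ.- + K) ℤ.-<+ ⟩
        (0ℤ ℤ.- + K) ℤ.+ 0ℤ                               ≡⟨ ℤP.+-identityʳ _ ⟩
        0ℤ ℤ.- + K                                        ≤⟨ ℤP.+-monoˡ-≤ (ℤ.- + K) (+≤+ z≤n) ⟩
        + c ℤ.- + K                                       ≡⟨ cong (ℤ._- + K) sum≡c ⟨
        ℤΣ.sum m ℤ.- + K                                  ≤⟨ ℤP.+-monoˡ-≤ (ℤ.- + K) (ℤP.+-monoʳ-≤ (m zero)
                                                              (sum-const-≤ (λ j → spread zero (suc j)))) ⟩
        (m zero ℤ.+ + K ℤ.* (m zero ℤ.+ 1ℤ)) ℤ.- + K      ≡⟨ rearrange₂ (+ K) (m zero) ⟩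
        (1ℤ ℤ.+ + K) ℤ.* m zero                           ≡⟨ cong (ℤ._* m zero) (ℤP.pos-+ 1 K) ⟨
        + n ℤ.* m zero                                    ∎

    binary : ∀ j → m j ≡ 0ℤ ⊎ m j ≡ 1ℤ
    binary j = 0≤i≤1⇒i≡0⊎i≡1 (subst (ℤ._≤ m j) first≡0 (lowest j)) (subst (λ x → m j ℤ.≤ x ℤ.+ 1ℤ) first≡0 (spread zero j))

    step : ∀ j → (r ℕ.≤ toℕ j → m j ≡ 1ℤ) × (toℕ j ℕ.< r → m j ≡ 0ℤ)
    step = monotone-binary⇒step c r c+r≡n m binary monotone sum≡c

    N-unrank : ∀ {i} → i ℕ.< n → N (position (unrank i)) ≡ + c ℤ.- + i
    N-unrank {i} i<n with i ℕ.<? c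
    ... | yes i<c = begin
      + n ℤ.* m j ℤ.- + toℕ j         ≡⟨ cong₂ (λ x y → + n ℤ.* x ℤ.- + y) (proj₁ (step j) r≤j) (toℕ-position j<n) ⟩
      + n ℤ.* 1ℤ ℤ.- + (i ℕ.+ r)      ≡⟨ cong₂ (λ x y → x ℤ.* 1ℤ ℤ.- y) (trans (cong +_ (sym c+r≡n)) (ℤP.pos-+ c r)) (ℤP.pos-+ i r) ⟩
      (+ c ℤ.+ + r) ℤ.* 1ℤ ℤ.- (+ i ℤ.+ + r) ≡⟨ cancel (+ c) (+ r) (+ i) ⟩
      + c ℤ.- + i                     ∎
      where
      open ≡-Reasoning
      j<n : i ℕ.+ r ℕ.< n
      j<n = subst (i ℕ.+ r ℕ.<_) c+r≡n (ℕP.+-monoˡ-< r i<c)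
      j : Fin n
      j = position (i ℕ.+ r)
      r≤j : r ℕ.≤ toℕ j
      r≤j = subst (r ℕ.≤_) (sym (toℕ-position j<n)) (ℕP.m≤n+m r i)
      cancel : ∀ c r i → (c ℤ.+ r) ℤ.* 1ℤ ℤ.- (i ℤ.+ r) ≡ c ℤ.- i
      cancel = solve-∀
    ... | no  i≮c = begin
      + n ℤ.* m j ℤ.- + toℕ j         ≡⟨ cong₂ (λ x y → + n ℤ.* x ℤ.- + y) (proj₂ (step j) (subst (ℕ._< r) (sym (toℕ-position j<n)) j<r)) (toℕ-position j<n) ⟩
      + n ℤ.* 0ℤ ℤ.- + (i ∸ c)        ≡⟨ cong (λ y → + n ℤ.* 0ℤ ℤ.- y) (trans (sym (ℤP.⊖-≥ c≤i)) (sym (ℤP.[+m]-[+n]≡m⊖n i c))) ⟩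
      + n ℤ.* 0ℤ ℤ.- (+ i ℤ.- + c)    ≡⟨ cancel (+ n) (+ i) (+ c) ⟩
      + c ℤ.- + i                     ∎
      where
      open ≡-Reasoning
      c≤i : c ℕ.≤ i
      c≤i = ℕP.≮⇒≥ i≮c
      j<r : i ∸ c ℕ.< r
      j<r = ℕP.+-cancelʳ-< c (i ∸ c) r
              (subst₂ ℕ._<_ (sym (ℕP.m∸n+n≡m c≤i)) (trans (sym c+r≡n) (ℕP.+-comm c r)) i<n)
      j<n : i ∸ c ℕ.< n
      j<n = ℕP.≤-<-trans (ℕP.m∸n≤m i c) i<n
      j : Fin n
      j = position (i ∸ c)
      cancel : ∀ n i c → n ℤ.* 0ℤ ℤ.- (i ℤ.- c) ≡ c ℤ.- i
      cancel = solve-∀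

    σ-unrank : ∀ {i} → i ℕ.< n → toℕ (σ (position (unrank i))) ≡ i
    σ-unrank = strictly-increasing⇒id n (λ i → toℕ (σ (position (unrank i)))) (λ _ → FinP.toℕ<n _) increases
      where
      increases : ∀ {i i′} → i ℕ.< i′ → i′ ℕ.< n → toℕ (σ (position (unrank i))) ℕ.< toℕ (σ (position (unrank i′)))
      increases {i} {i′} i<i′ i′<n with toℕ (σ (position (unrank i′))) ℕ.≤? toℕ (σ (position (unrank i)))
      ... | no  ≰ = ℕP.≰⇒> ≰
      ... | yes ≤ = ⊥-elim (ℤP.<⇒≱ (ℤP.+-monoʳ-< (+ c) (ℤP.neg-mono-< (+<+ i<i′)))
                      (subst₂ ℤ._≤_ (N-unrank (ℕP.<-trans i<i′ i′<n)) (N-unrank i′<n) (reversed _ _ ≤)))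

    rigidity : ∀ j → + toℕ (σ j) ℤ.+ + n ℤ.* m j ≡ + (toℕ j ℕ.+ c)
    rigidity j with r ℕ.≤? toℕ j
    ... | yes r≤j = begin
      + toℕ (σ j) ℤ.+ + n ℤ.* m j                 ≡⟨ cong₂ (λ x y → + toℕ (σ x) ℤ.+ + n ℤ.* y) (sym j≡) (proj₁ (step j) r≤j) ⟩
      + toℕ (σ (position (unrank i))) ℤ.+ + n ℤ.* 1ℤ ≡⟨ cong₂ (λ x y → + x ℤ.+ y) (σ-unrank i<n) (ℤP.*-identityʳ (+ n)) ⟩
      + i ℤ.+ + n                                 ≡⟨ cong (λ y → + i ℤ.+ + y) (sym c+r≡n) ⟩
      + (i ℕ.+ (c ℕ.+ r))                         ≡⟨ cong +_ (rotate i c r) ⟩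
      + ((i ℕ.+ r) ℕ.+ c)                         ≡⟨ cong (λ x → + (x ℕ.+ c)) (ℕP.m∸n+n≡m r≤j) ⟩
      + (toℕ j ℕ.+ c)                             ∎
      where
      open ≡-Reasoning
      i : ℕ
      i = toℕ j ∸ r
      i<n : i ℕ.< n
      i<n = ℕP.≤-<-trans (ℕP.m∸n≤m (toℕ j) r) (FinP.toℕ<n j)
      j≡ : position (unrank i) ≡ j
      j≡ = trans (cong position (unrank-upper j r≤j)) (position-toℕ j)
      rotate : ∀ i c r → i ℕ.+ (c ℕ.+ r) ≡ (i ℕ.+ r) ℕ.+ c
      rotate i c r = trans (cong (i ℕ.+_) (ℕP.+-comm c r)) (sym (ℕP.+-assoc i r c))
    ... | no  r≰j = begin
      + toℕ (σ j) ℤ.+ + n ℤ.* m j                 ≡⟨ cong₂ (λ x y → + toℕ (σ x) ℤ.+ + n ℤ.* y) (sym j≡) (proj₂ (step j) j<r) ⟩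
      + toℕ (σ (position (unrank i))) ℤ.+ + n ℤ.* 0ℤ ≡⟨ cong (λ x → + x ℤ.+ + n ℤ.* 0ℤ) (σ-unrank i<n) ⟩
      + i ℤ.+ + n ℤ.* 0ℤ                          ≡⟨ cong (λ x → + i ℤ.+ x) (ℤP.*-zeroʳ (+ n)) ⟩
      + i ℤ.+ 0ℤ                                  ≡⟨ ℤP.+-identityʳ (+ i) ⟩
      + i                                         ∎
      where
      open ≡-Reasoning
      j<r : toℕ j ℕ.< r
      j<r = ℕP.≰⇒> r≰j
      i : ℕ
      i = toℕ j ℕ.+ c
      i<n : i ℕ.< n
      i<n = subst (i ℕ.<_) (trans (ℕP.+-comm r c) c+r≡n) (ℕP.+-monoˡ-< c j<r)
      j≡ : position (unrank i) ≡ j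
      j≡ = trans (cong position (unrank-lower j j<r)) (position-toℕ j)

fromℚᵘ-homo-+ : ∀ u v → fromℚᵘ (u ℚᵘ.+ v) ≡ fromℚᵘ u ℚ.+ fromℚᵘ v
fromℚᵘ-homo-+ u v = ℚP.toℚᵘ-injective (begin
  toℚᵘ (fromℚᵘ (u ℚᵘ.+ v))              ≈⟨ ℚP.toℚᵘ-fromℚᵘ _ ⟩
  u ℚᵘ.+ v                              ≈⟨ ℚᵘP.+-cong (≃-sym (ℚP.toℚᵘ-fromℚᵘ u)) (≃-sym (ℚP.toℚᵘ-fromℚᵘ v)) ⟩
  toℚᵘ (fromℚᵘ u) ℚᵘ.+ toℚᵘ (fromℚᵘ v)  ≈⟨ ≃-sym (ℚP.toℚᵘ-homo-+ (fromℚᵘ u) (fromℚᵘ v)) ⟩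
  toℚᵘ (fromℚᵘ u ℚ.+ fromℚᵘ v)          ∎)
  where open ℚᵘP.≃-Reasoning; open ℚᵘP using (≃-sym)

fromℚᵘ-mono-≤ : ∀ {u v} → u ℚᵘ.≤ v → fromℚᵘ u ℚ.≤ fromℚᵘ v
fromℚᵘ-mono-≤ {u} {v} u≤v = ℚP.toℚᵘ-cancel-≤
  (ℚᵘP.≤-respʳ-≃ (ℚᵘP.≃-sym (ℚP.toℚᵘ-fromℚᵘ v)) (ℚᵘP.≤-respˡ-≃ (ℚᵘP.≃-sym (ℚP.toℚᵘ-fromℚᵘ u)) u≤v))

fromℚᵘ-cancel-≤ : ∀ {u v} → fromℚᵘ u ℚ.≤ fromℚᵘ v → u ℚᵘ.≤ v
fromℚᵘ-cancel-≤ {u} {v} u≤v =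
  ℚᵘP.≤-respʳ-≃ (ℚP.toℚᵘ-fromℚᵘ v) (ℚᵘP.≤-respˡ-≃ (ℚP.toℚᵘ-fromℚᵘ u) (ℚP.toℚᵘ-mono-≤ u≤v))

infixl 7 _/[1+_]

_/[1+_] : ℤ → ℕ → ℚ
z /[1+ d ] = fromℚᵘ (mkℚᵘ z d)

/[1+]-homo-+ : ∀ d a b → (a ℤ.+ b) /[1+ d ] ≡ a /[1+ d ] ℚ.+ b /[1+ d ]
/[1+]-homo-+ d a b =
  trans (ℚP.fromℚᵘ-cong {mkℚᵘ (a ℤ.+ b) d} {mkℚᵘ a d ℚᵘ.+ mkℚᵘ b d} (*≡* (same-denominator a b (+ suc d)))) (fromℚᵘ-homo-+ (mkℚᵘ a d) (mkℚᵘ b d))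
  where
  same-denominator : ∀ a b m → (a ℤ.+ b) ℤ.* (m ℤ.* m) ≡ (a ℤ.* m ℤ.+ b ℤ.* m) ℤ.* m
  same-denominator = solve-∀

*[1+]/[1+] : ∀ d z → (z ℤ.* + suc d) /[1+ d ] ≡ z /[1+ 0 ]
*[1+]/[1+] d z = ℚP.fromℚᵘ-cong {mkℚᵘ (z ℤ.* + suc d) d} {mkℚᵘ z 0} (*≡* (ℤP.*-identityʳ (z ℤ.* + suc d)))

/[1+]-mono-≤ : ∀ d {a b} → a ℤ.≤ b → a /[1+ d ] ℚ.≤ b /[1+ d ]
/[1+]-mono-≤ d {a} {b} a≤b = fromℚᵘ-mono-≤ {mkℚᵘ a d} {mkℚᵘ b d} (*≤* (ℤP.*-monoʳ-≤-nonNeg (+ suc d) a≤b))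

/[1+]-cancel-≤ : ∀ d {a b} → a /[1+ d ] ℚ.≤ b /[1+ d ] → a ℤ.≤ b
/[1+]-cancel-≤ d {a} {b} a≤b with fromℚᵘ-cancel-≤ {mkℚᵘ a d} {mkℚᵘ b d} a≤b
... | *≤* a*n≤b*n = ℤP.*-cancelʳ-≤-pos a b (+ suc d) a*n≤b*n

/[1+]-injective : ∀ d {a b} → a /[1+ d ] ≡ b /[1+ d ] → a ≡ b
/[1+]-injective d eq =
  ℤP.≤-antisym (/[1+]-cancel-≤ d (ℚP.≤-reflexive eq)) (/[1+]-cancel-≤ d (ℚP.≤-reflexive (sym eq)))


sum-/[1+] : ∀ d {n} (f : Fin n → ℤ) → ℚΣ.sum (λ j → f j /[1+ d ]) ≡ ℤΣ.sum f /[1+ d ]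
sum-/[1+] d {zero}  f = ℚP.fromℚᵘ-cong {ℚᵘ.0ℚᵘ} {mkℚᵘ (+ 0) d} (*≡* refl)
sum-/[1+] d {suc n} f =
  trans (cong (f zero /[1+ d ] ℚ.+_) (sum-/[1+] d (f ∘ suc))) (sym (/[1+]-homo-+ d (f zero) (ℤΣ.sum (f ∘ suc))))

/[1+]-minus-one : ∀ d x → x /[1+ d ] ℚ.- 1ℚ ≡ (x ℤ.- + suc d) /[1+ d ]
/[1+]-minus-one d x = sym (begin
  (x ℤ.- + suc d) /[1+ d ]                    ≡⟨ /[1+]-homo-+ d x (ℤ.- + suc d) ⟩
  x /[1+ d ] ℚ.+ (ℤ.- + suc d) /[1+ d ]       ≡⟨ cong (λ y → x /[1+ d ] ℚ.+ y /[1+ d ]) (sym (ℤP.-1*i≡-i (+ suc d))) ⟩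
  x /[1+ d ] ℚ.+ (-1ℤ ℤ.* + suc d) /[1+ d ] ≡⟨ cong (x /[1+ d ] ℚ.+_) (*[1+]/[1+] d -1ℤ) ⟩
  x /[1+ d ] ℚ.- 1ℚ                         ∎)
  where open ≡-Reasoning

-- Generators of W acting on windows and on V

coord-suc : ∀ {k} (a : Point k) {m} (ρ : Fin (suc k)) → toℕ ρ ≡ m → coord a (suc m) ≡ a ρ
coord-suc {k} a {m} ρ refl with toℕ ρ ℕ.<? suc k
... | yes ρ<n = cong a (FinP.fromℕ<-toℕ ρ ρ<n)
... | no  ρ≮n = ⊥-elim (ρ≮n (FinP.toℕ<n ρ))

≡ᵇ⇒≡ : ∀ {m n} → (m ≡ᵇ n) ≡ true → m ≡ n
≡ᵇ⇒≡ {m} {n} eq = ℕP.≡ᵇ⇒≡ m n (subst T (sym eq) tt)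

-- For k = 0 the window of s₀ and its action on V disagree, hence k = suc k′.
module Generators (k′ : ℕ) where

  K n : ℕ
  K = suc k′
  n = suc K

  -- s_i exchanges the coordinates at the 0-based positions partner i and i;
  -- only s₀ wraps around, moving them by ∓1.
  partner : Fin n → Fin n
  partner zero     = fromℕ K
  partner (suc i₀) = inject₁ i₀

  winding : Fin n → ℤ
  winding zero    = 1ℤ
  winding (suc _) = 0ℤ

  genAct-at-partner : ∀ i a → genAct K i a (partner i) ≡ a i ℚ.- winding i /[1+ 0 ]
  genAct-at-partner zero a with toℕ (fromℕ k′) ≡ᵇ k′ in eq
  ... | true  = cong (ℚ._- 1ℚ) (coord-suc a zero refl)
  ... | false = ⊥-elim (subst T eq (ℕP.≡⇒≡ᵇ _ _ (FinP.toℕ-fromℕ k′)))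
  genAct-at-partner (suc i₀) a with toℕ (inject₁ i₀) ≡ᵇ toℕ i₀ in eq
  ... | true  = trans (coord-suc a (suc i₀) refl) (sym (ℚP.+-identityʳ _))
  ... | false = ⊥-elim (subst T eq (ℕP.≡⇒≡ᵇ _ _ (FinP.toℕ-inject₁ i₀)))

  genAct-at-self : ∀ i a → genAct K i a i ≡ a (partner i) ℚ.+ winding i /[1+ 0 ]
  genAct-at-self zero a = cong (ℚ._+ 1ℚ) (coord-suc a (fromℕ K) (FinP.toℕ-fromℕ K))
  genAct-at-self (suc i₀) a with suc (toℕ i₀) ≡ᵇ toℕ i₀ in eq₁
  ... | true  = ⊥-elim (ℕP.1+n≢n (≡ᵇ⇒≡ {suc (toℕ i₀)} eq₁))
  ... | false with toℕ i₀ ≡ᵇ toℕ i₀ in eq₂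
  ...   | true  = trans (coord-suc a (inject₁ i₀) (FinP.toℕ-inject₁ i₀)) (sym (ℚP.+-identityʳ _))
  ...   | false = ⊥-elim (subst T eq₂ (ℕP.≡⇒≡ᵇ (toℕ i₀) _ refl))

  genAct-elsewhere : ∀ i a p → p ≢ partner i → p ≢ i → genAct K i a p ≡ a p
  genAct-elsewhere zero a p p≢u p≢i with toℕ p ≡ᵇ 0 in eq₁
  ... | true  = ⊥-elim (p≢i (FinP.toℕ-injective (≡ᵇ⇒≡ eq₁)))
  ... | false with toℕ p ≡ᵇ K in eq₂
  ...   | true  = ⊥-elim (p≢u (FinP.toℕ-injective (trans (≡ᵇ⇒≡ eq₂) (sym (FinP.toℕ-fromℕ K)))))
  ...   | false = refl
  genAct-elsewhere (suc i₀) a p p≢u p≢i with toℕ p ≡ᵇ toℕ i₀ in eq₁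
  ... | true  = ⊥-elim (p≢u (FinP.toℕ-injective (trans (≡ᵇ⇒≡ eq₁) (sym (FinP.toℕ-inject₁ i₀)))))
  ... | false with toℕ p ≡ᵇ suc (toℕ i₀) in eq₂
  ...   | true  = ⊥-elim (p≢i (FinP.toℕ-injective (≡ᵇ⇒≡ eq₂)))
  ...   | false = refl

  genW-entry : Fin n → Fin n → ℤ
  genW-entry i p =
    let j = suc (toℕ p) ; ii = toℕ i in
    if ii ≡ᵇ 0
      then (if j ≡ᵇ suc K then + suc j else if j ≡ᵇ 1 then + 0 else + j)
      else (if j ≡ᵇ ii then + suc j else if j ≡ᵇ suc ii then + ii else + j)

  lookup-genW : ∀ i p → lookup (genW K i) p ≡ genW-entry i p
  lookup-genW i = VecP.lookup∘tabulate (genW-entry i)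

  genW-at-partner : ∀ i → lookup (genW K i) (partner i) ℤ.- 1ℤ ≡ + toℕ i ℤ.+ winding i ℤ.* + n
  genW-at-partner i = trans (cong (ℤ._- 1ℤ) (lookup-genW i (partner i))) (entry i)
    where
    entry : ∀ i → genW-entry i (partner i) ℤ.- 1ℤ ≡ + toℕ i ℤ.+ winding i ℤ.* + n
    entry zero with toℕ (fromℕ k′) ≡ᵇ k′ in eq
    ... | true  rewrite FinP.toℕ-fromℕ k′ = sym (ℤP.*-identityˡ (+ n))
    ... | false = ⊥-elim (subst T eq (ℕP.≡⇒≡ᵇ _ _ (FinP.toℕ-fromℕ k′)))
    entry (suc i₀) with toℕ (inject₁ i₀) ≡ᵇ toℕ i₀ in eq
    ... | true  rewrite FinP.toℕ-inject₁ i₀ = sym (ℤP.+-identityʳ _)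
    ... | false = ⊥-elim (subst T eq (ℕP.≡⇒≡ᵇ _ _ (FinP.toℕ-inject₁ i₀)))

  genW-at-self : ∀ i → lookup (genW K i) i ℤ.- 1ℤ ≡ + toℕ (partner i) ℤ.+ ℤ.- winding i ℤ.* + n
  genW-at-self i = trans (cong (ℤ._- 1ℤ) (lookup-genW i i)) (entry i)
    where
    wrap-around : ∀ m → -1ℤ ≡ m ℤ.+ -1ℤ ℤ.* (1ℤ ℤ.+ m)
    wrap-around = solve-∀
    entry : ∀ i → genW-entry i i ℤ.- 1ℤ ≡ + toℕ (partner i) ℤ.+ ℤ.- winding i ℤ.* + n
    entry zero rewrite FinP.toℕ-fromℕ k′ = wrap-around (+ K)
    entry (suc i₀) with suc (toℕ i₀) ≡ᵇ toℕ i₀ in eq₁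
    ... | true  = ⊥-elim (ℕP.1+n≢n (≡ᵇ⇒≡ {suc (toℕ i₀)} eq₁))
    ... | false with toℕ i₀ ≡ᵇ toℕ i₀ in eq₂
    ...   | true  rewrite FinP.toℕ-inject₁ i₀ = sym (ℤP.+-identityʳ _)
    ...   | false = ⊥-elim (subst T eq₂ (ℕP.≡⇒≡ᵇ (toℕ i₀) _ refl))

  genW-elsewhere : ∀ i p → p ≢ partner i → p ≢ i → lookup (genW K i) p ≡ + suc (toℕ p)
  genW-elsewhere i p p≢u p≢i = trans (lookup-genW i p) (entry i p p≢u p≢i)
    where
    entry : ∀ i p → p ≢ partner i → p ≢ i → genW-entry i p ≡ + suc (toℕ p)
    entry zero p p≢u p≢i with toℕ p ≡ᵇ K in eq₁
    ... | true  = ⊥-elim (p≢u (FinP.toℕ-injective (trans (≡ᵇ⇒≡ eq₁) (sym (FinP.toℕ-fromℕ K)))))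
    ... | false with toℕ p ≡ᵇ 0 in eq₂
    ...   | true  = ⊥-elim (p≢i (FinP.toℕ-injective (≡ᵇ⇒≡ eq₂)))
    ...   | false = refl
    entry (suc i₀) p p≢u p≢i with toℕ p ≡ᵇ toℕ i₀ in eq₁
    ... | true  = ⊥-elim (p≢u (FinP.toℕ-injective (trans (≡ᵇ⇒≡ eq₁) (sym (FinP.toℕ-inject₁ i₀)))))
    ... | false with toℕ p ≡ᵇ suc (toℕ i₀) in eq₂
    ...   | true  = ⊥-elim (p≢i (FinP.toℕ-injective (≡ᵇ⇒≡ eq₂)))
    ...   | false = refl

  partner≢self : ∀ i → partner i ≢ i
  partner≢self zero     ()
  partner≢self (suc i₀) eq = ℕP.1+n≢n (sym (trans (sym (FinP.toℕ-inject₁ i₀)) (cong toℕ eq)))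

  generator-window-action : ∀ i p → ∃₂ λ p′ e →
    lookup (genW K i) p ℤ.- 1ℤ ≡ + toℕ p′ ℤ.+ e ℤ.* + n ×
    (∀ a → genAct K i a p ≡ a p′ ℚ.- e /[1+ 0 ])
  generator-window-action i p with p Fin.≟ partner i | p Fin.≟ i
  ... | yes refl | _        = i , winding i , genW-at-partner i , genAct-at-partner i
  ... | no _     | yes refl = partner i , ℤ.- winding i , genW-at-self i ,
                              λ a → trans (genAct-at-self i a) (cong (a (partner i) ℚ.+_) (negated i))
    where
    negated : ∀ i → winding i /[1+ 0 ] ≡ ℚ.- ((ℤ.- winding i) /[1+ 0 ])
    negated zero    = refl
    negated (suc _) = refl
  ... | no p≢u   | no p≢i   = p , 0ℤ ,
                              trans (cong (ℤ._- 1ℤ) (genW-elsewhere i p p≢u p≢i)) (sym (ℤP.+-identityʳ _)) ,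
                              λ a → trans (genAct-elsewhere i a p p≢u p≢i) (sym (ℚP.+-identityʳ (a p)))

  genAct-preserves-sum : ∀ i a → ℚΣ.sum (genAct K i a) ≡ ℚΣ.sum a
  genAct-preserves-sum i a = begin
    ℚΣ.sum (genAct K i a)                 ≡⟨ ℚΣ.sum-cong-≗ (λ p → sym (a+[b-a] (a p) (genAct K i a p))) ⟩
    ℚΣ.sum (λ p → a p ℚ.+ change p)       ≡⟨ ℚΣ.∑-distrib-+ a change ⟩
    ℚΣ.sum a ℚ.+ ℚΣ.sum change            ≡⟨ cong (ℚΣ.sum a ℚ.+_) total-change ⟩
    ℚΣ.sum a ℚ.+ 0ℚ                       ≡⟨ ℚP.+-identityʳ _ ⟩
    ℚΣ.sum a                              ∎
    where
    open ≡-Reasoning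
    open +-*-Solver
    change : Point K
    change p = genAct K i a p ℚ.- a p
    a+[b-a] : ∀ x y → x ℚ.+ (y ℚ.- x) ≡ y
    a+[b-a] = solve 2 (λ x y → x :+ (y :- x) := y) refl
    swap-cancels : ∀ x y w → ((x ℚ.- w) ℚ.- y) ℚ.+ ((y ℚ.+ w) ℚ.- x) ≡ 0ℚ
    swap-cancels = solve 3 (λ x y w → ((x :- w) :- y) :+ ((y :+ w) :- x) := con 0ℚ) refl
    total-change : ℚΣ.sum change ≡ 0ℚ
    total-change = begin
      ℚΣ.sum change                         ≡⟨ sum-supported-at-two ℚP.+-0-commutativeMonoid change (partner i) i (partner≢self i)
                                                 (λ p p≢u p≢i → trans (cong (ℚ._- a p) (genAct-elsewhere i a p p≢u p≢i)) (ℚP.+-inverseʳ (a p))) ⟩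
      change (partner i) ℚ.+ change i       ≡⟨ cong₂ (λ x y → (x ℚ.- a (partner i)) ℚ.+ (y ℚ.- a i)) (genAct-at-partner i a) (genAct-at-self i a) ⟩
      ((a i ℚ.- w) ℚ.- a (partner i)) ℚ.+ ((a (partner i) ℚ.+ w) ℚ.- a i) ≡⟨ swap-cancels (a i) (a (partner i)) w ⟩
      0ℚ                                    ∎
      where w = winding i /[1+ 0 ]

residue : ∀ k → ℤ → Fin (suc k)
residue k m = fromℕ< (n%ℕd<d (m ℤ.- 1ℤ) (suc k))

winding-of : ∀ k → ℤ → ℤ
winding-of k m = (m ℤ.- 1ℤ) /ℕ suc k

residue-winding : ∀ k m → m ℤ.- 1ℤ ≡ + toℕ (residue k m) ℤ.+ winding-of k m ℤ.* + suc k
residue-winding k m = trans (a≡a%ℕn+[a/ℕn]*n (m ℤ.- 1ℤ) (suc k))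
  (cong (λ ρ → + ρ ℤ.+ winding-of k m ℤ.* + suc k) (sym (FinP.toℕ-fromℕ< (n%ℕd<d (m ℤ.- 1ℤ) (suc k)))))

lookup-idW : ∀ k j → lookup (idW k) j ≡ + suc (toℕ j)
lookup-idW k = VecP.lookup∘tabulate (λ p → + suc (toℕ p))

lookup-·W : ∀ k (v w : Window k) j →
            lookup (v ·W w) j ≡ lookup v (residue k (lookup w j)) ℤ.+ winding-of k (lookup w j) ℤ.* + suc k
lookup-·W k v w = VecP.lookup∘tabulate (λ p → evalW k v (lookup w p))

wordAct-reverse-∷ : ∀ k i ws (a : Point k) →
                    wordAct k (reverse (i ∷ ws)) a ≡ wordAct k (reverse ws) (genAct k i a)
wordAct-reverse-∷ k i ws a rewrite ListP.unfold-reverse i ws = ListP.foldr-++ (genAct k) a (reverse ws) (i ∷ [])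

module Words (k′ : ℕ) where
  open Generators k′

  wordAct-reads-window : ∀ ws (a : Point K) j ρ q →
    lookup (wordW K ws) j ℤ.- 1ℤ ≡ + toℕ ρ ℤ.+ q ℤ.* + n →
    wordAct K (reverse ws) a j ≡ a ρ ℚ.- q /[1+ 0 ]
  wordAct-reads-window [] a j ρ q eq =
    trans (sym (ℚP.+-identityʳ (a j))) (cong₂ (λ u v → a u ℚ.- v /[1+ 0 ]) (FinP.toℕ-injective j≡ρ) 0≡q)
    where
    id-entry : + toℕ j ℤ.+ 0ℤ ℤ.* + n ≡ + toℕ ρ ℤ.+ q ℤ.* + n
    id-entry = trans (ℤP.+-identityʳ _) (trans (cong (ℤ._- 1ℤ) (sym (lookup-idW K j))) eq)
    0≡q : 0ℤ ≡ q
    0≡q = proj₁ (divMod-unique n 0ℤ q (FinP.toℕ<n j) (FinP.toℕ<n ρ) id-entry)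
    j≡ρ : toℕ j ≡ toℕ ρ
    j≡ρ = proj₂ (divMod-unique n 0ℤ q (FinP.toℕ<n j) (FinP.toℕ<n ρ) id-entry)
  wordAct-reads-window (i ∷ ws) a j ρ q eq
    with generator-window-action i (residue K (lookup (wordW K ws) j))
  ... | ρ″ , e , entry , act = begin
    wordAct K (reverse (i ∷ ws)) a j              ≡⟨ cong-app (wordAct-reverse-∷ K i ws a) j ⟩
    wordAct K (reverse ws) (genAct K i a) j       ≡⟨ wordAct-reads-window ws (genAct K i a) j _ q′ (residue-winding K w) ⟩
    genAct K i a (residue K w) ℚ.- q′ /[1+ 0 ]    ≡⟨ cong (ℚ._- q′ /[1+ 0 ]) (act a) ⟩
    (a ρ″ ℚ.- e /[1+ 0 ]) ℚ.- q′ /[1+ 0 ]         ≡⟨ sub-sub (a ρ″) (e /[1+ 0 ]) (q′ /[1+ 0 ]) ⟩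
    a ρ″ ℚ.- (e /[1+ 0 ] ℚ.+ q′ /[1+ 0 ])         ≡⟨ cong (λ x → a ρ″ ℚ.- x) (sym (/[1+]-homo-+ 0 e q′)) ⟩
    a ρ″ ℚ.- (e ℤ.+ q′) /[1+ 0 ]                  ≡⟨ cong₂ (λ u v → a u ℚ.- v /[1+ 0 ]) (FinP.toℕ-injective ρ″≡ρ) e+q′≡q ⟩
    a ρ ℚ.- q /[1+ 0 ]                            ∎
    where
    open ≡-Reasoning
    w : ℤ
    w = lookup (wordW K ws) j
    q′ : ℤ
    q′ = winding-of K w
    sub-sub : ∀ x y z → (x ℚ.- y) ℚ.- z ≡ x ℚ.- (y ℚ.+ z)
    sub-sub = solve 3 (λ x y z → (x :- y) :- z := x :- (y :+ z)) refl
      where open +-*-Solver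
    regroup : ∀ x y z → (x ℤ.+ y ℤ.* z) ℤ.- 1ℤ ≡ (x ℤ.- 1ℤ) ℤ.+ y ℤ.* z
    regroup = solve-∀
    collect : ∀ r e q z → (r ℤ.+ e ℤ.* z) ℤ.+ q ℤ.* z ≡ r ℤ.+ (e ℤ.+ q) ℤ.* z
    collect = solve-∀
    composite : + toℕ ρ″ ℤ.+ (e ℤ.+ q′) ℤ.* + n ≡ + toℕ ρ ℤ.+ q ℤ.* + n
    composite = begin
      + toℕ ρ″ ℤ.+ (e ℤ.+ q′) ℤ.* + n                       ≡⟨ collect (+ toℕ ρ″) e q′ (+ n) ⟨
      (+ toℕ ρ″ ℤ.+ e ℤ.* + n) ℤ.+ q′ ℤ.* + n               ≡⟨ cong (ℤ._+ q′ ℤ.* + n) entry ⟨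
      (lookup (genW K i) (residue K w) ℤ.- 1ℤ) ℤ.+ q′ ℤ.* + n ≡⟨ regroup (lookup (genW K i) (residue K w)) q′ (+ n) ⟨
      (lookup (genW K i) (residue K w) ℤ.+ q′ ℤ.* + n) ℤ.- 1ℤ ≡⟨ cong (ℤ._- 1ℤ) (lookup-·W K (genW K i) (wordW K ws) j) ⟨
      lookup (wordW K (i ∷ ws)) j ℤ.- 1ℤ                    ≡⟨ eq ⟩
      + toℕ ρ ℤ.+ q ℤ.* + n                                 ∎
    e+q′≡q : e ℤ.+ q′ ≡ q
    e+q′≡q = proj₁ (divMod-unique n (e ℤ.+ q′) q (FinP.toℕ<n ρ″) (FinP.toℕ<n ρ) composite)
    ρ″≡ρ : toℕ ρ″ ≡ toℕ ρ
    ρ″≡ρ = proj₂ (divMod-unique n (e ℤ.+ q′) q (FinP.toℕ<n ρ″) (FinP.toℕ<n ρ) composite)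

  wordAct-preserves-sum : ∀ ws (a : Point K) → ℚΣ.sum (wordAct K (reverse ws) a) ≡ ℚΣ.sum a
  wordAct-preserves-sum []       a = refl
  wordAct-preserves-sum (i ∷ ws) a = begin
    ℚΣ.sum (wordAct K (reverse (i ∷ ws)) a)      ≡⟨ cong ℚΣ.sum (wordAct-reverse-∷ K i ws a) ⟩
    ℚΣ.sum (wordAct K (reverse ws) (genAct K i a)) ≡⟨ wordAct-preserves-sum ws (genAct K i a) ⟩
    ℚΣ.sum (genAct K i a)                        ≡⟨ genAct-preserves-sum i a ⟩
    ℚΣ.sum a                                     ∎
    where open ≡-Reasoning

  windings-sum-to-zero : ∀ ws → ℤΣ.sum (λ j → winding-of K (lookup (wordW K ws) j)) ≡ 0ℤ
  -- w⁻¹ maps the origin to (-q_j)_j, and the action preserves coordinate sums.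
  windings-sum-to-zero ws = /[1+]-injective 0 (begin
    ℤΣ.sum Q /[1+ 0 ]                               ≡⟨ sum-/[1+] 0 Q ⟨
    ℚΣ.sum (λ j → Q j /[1+ 0 ])                     ≡⟨ ℚP.+-identityˡ _ ⟨
    0ℚ ℚ.+ ℚΣ.sum (λ j → Q j /[1+ 0 ])              ≡⟨ cong (ℚ._+ ℚΣ.sum (λ j → Q j /[1+ 0 ])) sum-image-of-origin ⟨
    ℚΣ.sum image-of-origin ℚ.+ ℚΣ.sum (λ j → Q j /[1+ 0 ]) ≡⟨ ℚΣ.∑-distrib-+ image-of-origin (λ j → Q j /[1+ 0 ]) ⟨
    ℚΣ.sum (λ j → image-of-origin j ℚ.+ Q j /[1+ 0 ]) ≡⟨ ℚΣ.sum-cong-≗ cancels ⟩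
    ℚΣ.sum origin                                   ≡⟨ sum-vanishing ℚP.+-0-commutativeMonoid origin (λ _ → refl) ⟩
    0ℚ                                              ∎)
    where
    open ≡-Reasoning
    Q : Fin n → ℤ
    Q j = winding-of K (lookup (wordW K ws) j)
    origin : Point K
    origin _ = 0ℚ
    image-of-origin : Point K
    image-of-origin = wordAct K (reverse ws) origin
    sum-image-of-origin : ℚΣ.sum image-of-origin ≡ 0ℚ
    sum-image-of-origin = trans (wordAct-preserves-sum ws origin) (sum-vanishing ℚP.+-0-commutativeMonoid origin (λ _ → refl))
    cancels : ∀ j → image-of-origin j ℚ.+ Q j /[1+ 0 ] ≡ 0ℚ
    cancels j = begin
      image-of-origin j ℚ.+ Q j /[1+ 0 ] ≡⟨ cong (ℚ._+ Q j /[1+ 0 ]) (wordAct-reads-window ws origin j (residue K w) (Q j) (residue-winding K w)) ⟩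
      (0ℚ ℚ.- Q j /[1+ 0 ]) ℚ.+ Q j /[1+ 0 ] ≡⟨ cong (ℚ._+ Q j /[1+ 0 ]) (ℚP.+-identityˡ (ℚ.- (Q j /[1+ 0 ]))) ⟩
      ℚ.- (Q j /[1+ 0 ]) ℚ.+ Q j /[1+ 0 ] ≡⟨ ℚP.+-inverseˡ (Q j /[1+ 0 ]) ⟩
      0ℚ                                  ∎
      where w = lookup (wordW K ws) j

module _ {k} {a : Point k} (a∈A∅ : InA∅ k a) where

  coord-antitone : ∀ d m → m ℕ.+ d ℕ.< suc k → coord a (suc (m ℕ.+ d)) ℚ.≤ coord a (suc m)
  coord-antitone zero    m _ = ℚP.≤-reflexive (cong (λ x → coord a (suc x)) (ℕP.+-identityʳ m))
  coord-antitone (suc d) m m+1+d<n = ℚP.≤-trans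
    (subst (λ x → coord a (suc x) ℚ.≤ coord a (suc (m ℕ.+ d))) (sym (ℕP.+-suc m d))
      (proj₁ a∈A∅ (m ℕ.+ d) (ℕ.s≤s⁻¹ (subst (ℕ._< suc k) (ℕP.+-suc m d) m+1+d<n))))
    (coord-antitone d m (ℕP.<-trans (ℕP.n<1+n _) (subst (ℕ._< suc k) (ℕP.+-suc m d) m+1+d<n)))

  InA∅-antitone : ∀ {ρ ρ′} → toℕ ρ ℕ.≤ toℕ ρ′ → a ρ′ ℚ.≤ a ρ
  InA∅-antitone {ρ} {ρ′} ρ≤ρ′ = subst₂ ℚ._≤_
    (coord-suc a ρ′ (sym (ℕP.m+[n∸m]≡n ρ≤ρ′))) (coord-suc a ρ refl)
    (coord-antitone (toℕ ρ′ ∸ toℕ ρ) (toℕ ρ) (subst (ℕ._< suc k) (sym (ℕP.m+[n∸m]≡n ρ≤ρ′)) (FinP.toℕ<n ρ′)))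

  InA∅-width : ∀ ρ ρ′ → a ρ ℚ.- 1ℚ ℚ.≤ a ρ′
  InA∅-width ρ ρ′ = begin
    a ρ ℚ.- 1ℚ            ≤⟨ ℚP.+-monoˡ-≤ (ℚ.- 1ℚ) (InA∅-antitone {zero} {ρ} z≤n) ⟩
    a zero ℚ.- 1ℚ         ≡⟨ cong (ℚ._- 1ℚ) (coord-suc a zero refl) ⟨
    coord a 1 ℚ.- 1ℚ      ≤⟨ proj₂ a∈A∅ ⟩
    coord a (suc k)       ≡⟨ coord-suc a (fromℕ k) (FinP.toℕ-fromℕ k) ⟩
    a (fromℕ k)           ≤⟨ InA∅-antitone {ρ′} {fromℕ k} (subst (toℕ ρ′ ℕ.≤_) (sym (FinP.toℕ-fromℕ k)) (ℕ.s≤s⁻¹ (FinP.toℕ<n ρ′))) ⟩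
    a ρ′                  ∎
    where open ℚP.≤-Reasoning

staircase : ∀ k → Point k
staircase k j = (ℤ.- + toℕ j) /[1+ k ]

staircase-InA∅ : ∀ k → InA∅ k (staircase k)
staircase-InA∅ k = descending , closing
  where
  descending : ∀ m → m ℕ.< k → coord (staircase k) (suc (suc m)) ℚ.≤ coord (staircase k) (suc m)
  descending m m<k = subst₂ ℚ._≤_
    (sym (coord-suc (staircase k) (fromℕ< (s≤s m<k)) (FinP.toℕ-fromℕ< (s≤s m<k))))
    (sym (coord-suc (staircase k) (fromℕ< m<n) (FinP.toℕ-fromℕ< m<n)))
    (subst₂ (λ u v → (ℤ.- + u) /[1+ k ] ℚ.≤ (ℤ.- + v) /[1+ k ]) (sym (FinP.toℕ-fromℕ< (s≤s m<k))) (sym (FinP.toℕ-fromℕ< m<n))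
      (/[1+]-mono-≤ k (ℤP.neg-mono-≤ (ℤ.+≤+ (ℕP.n≤1+n m)))))
    where
    m<n : m ℕ.< suc k
    m<n = ℕP.<-trans m<k (ℕP.n<1+n k)
  closing : coord (staircase k) 1 ℚ.- 1ℚ ℚ.≤ coord (staircase k) (suc k)
  closing = subst₂ ℚ._≤_ (sym (/[1+]-minus-one k (ℤ.- + 0)))
    (sym (trans (coord-suc (staircase k) (fromℕ k) (FinP.toℕ-fromℕ k)) (cong (λ u → (ℤ.- + u) /[1+ k ]) (FinP.toℕ-fromℕ k))))
    (/[1+]-mono-≤ k (ℤP.neg-mono-≤ (ℤ.+≤+ (ℕP.n≤1+n k))))

-- The translated alcove A_∅ + γ

indicatorℤ : ∀ {m} → Subset m → Fin m → ℤ
indicatorℤ γ j = if lookup γ j then 1ℤ else 0ℤ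

sum-indicatorℤ : ∀ {m} (γ : Subset m) → ℤΣ.sum (indicatorℤ γ) ≡ + ∣ γ ∣
sum-indicatorℤ []          = refl
sum-indicatorℤ (true ∷ γ)  = cong (λ s → 1ℤ ℤ.+ s) (sum-indicatorℤ γ)
sum-indicatorℤ (false ∷ γ) = trans (ℤP.+-identityˡ _) (sum-indicatorℤ γ)

indicator-/[1+] : ∀ {k} (γ : Subset (suc k)) j → indicator γ j ≡ indicatorℤ γ j /[1+ 0 ]
indicator-/[1+] γ j with lookup γ j
... | true  = refl
... | false = refl

module TranslatedAlcove (k′ c r : ℕ) (r≥1 : 1 ≤ r) (c+r≡n : c + r ≡ suc (suc k′))
                 (γ : Subset (suc (suc k′))) (|γ|≡c : ∣ γ ∣ ≡ c) (w : Window (suc k′))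
                 (A≡A∅+γ : AlcoveIsShift (suc k′) w (indicator γ)) where
  open Generators k′ using (K; n)
  open Words k′

  x : Point K
  x j = staircase K j ℚ.+ indicator γ j

  alcove : InAlcove K w x
  alcove = proj₂ (A≡A∅+γ x) (staircase K , staircase-InA∅ K , 0ℚ , λ j → sym (ℚP.+-identityʳ (x j)))

  module _ (ws : List (Fin n)) (a : Point K) (a∈A∅ : InA∅ K a) (t : ℚ)
           (x≈ : ∀ j → x j ≡ wordAct K (reverse ws) a j ℚ.+ t) where

    σ : Fin n → Fin n
    σ j = residue K (lookup (wordW K ws) j)

    q g m : Fin n → ℤ
    q j = winding-of K (lookup (wordW K ws) j)
    g = indicatorℤ γ
    m j = g j ℤ.+ q j

    open Rigidity K c r c+r≡n r≥1 m σ using (N; rigidity)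

    N-position : ∀ j → N j /[1+ K ] ≡ a (σ j) ℚ.+ t
    N-position j = begin
      (+ n ℤ.* m j ℤ.- + toℕ j) /[1+ K ]                 ≡⟨ /[1+]-homo-+ K (+ n ℤ.* m j) (ℤ.- + toℕ j) ⟩
      (+ n ℤ.* m j) /[1+ K ] ℚ.+ staircase K j           ≡⟨ cong (λ y → y /[1+ K ] ℚ.+ staircase K j) (ℤP.*-comm (+ n) (m j)) ⟩
      (m j ℤ.* + n) /[1+ K ] ℚ.+ staircase K j           ≡⟨ cong (ℚ._+ staircase K j) (*[1+]/[1+] K (m j)) ⟩
      m j /[1+ 0 ] ℚ.+ staircase K j                     ≡⟨ cong (ℚ._+ staircase K j) (/[1+]-homo-+ 0 (g j) (q j)) ⟩
      (g j /[1+ 0 ] ℚ.+ q j /[1+ 0 ]) ℚ.+ staircase K j  ≡⟨ regroup (g j /[1+ 0 ]) (q j /[1+ 0 ]) (staircase K j) ⟩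
      (staircase K j ℚ.+ g j /[1+ 0 ]) ℚ.+ q j /[1+ 0 ]  ≡⟨ cong (λ y → (staircase K j ℚ.+ y) ℚ.+ q j /[1+ 0 ]) (sym (indicator-/[1+] γ j)) ⟩
      x j ℚ.+ q j /[1+ 0 ]                               ≡⟨ cong (ℚ._+ q j /[1+ 0 ]) (x≈ j) ⟩
      (wordAct K (reverse ws) a j ℚ.+ t) ℚ.+ q j /[1+ 0 ] ≡⟨ cong (λ y → (y ℚ.+ t) ℚ.+ q j /[1+ 0 ])
                                                             (wordAct-reads-window ws a j (σ j) (q j) (residue-winding K (lookup (wordW K ws) j))) ⟩
      ((a (σ j) ℚ.- q j /[1+ 0 ]) ℚ.+ t) ℚ.+ q j /[1+ 0 ] ≡⟨ cancel (a (σ j)) (q j /[1+ 0 ]) t ⟩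
      a (σ j) ℚ.+ t                                      ∎
      where
      open ≡-Reasoning
      open +-*-Solver
      regroup : ∀ G Q P → (G ℚ.+ Q) ℚ.+ P ≡ (P ℚ.+ G) ℚ.+ Q
      regroup = solve 3 (λ G Q P → (G :+ Q) :+ P := (P :+ G) :+ Q) refl
      cancel : ∀ A Q T → ((A ℚ.- Q) ℚ.+ T) ℚ.+ Q ≡ A ℚ.+ T
      cancel = solve 3 (λ A Q T → ((A :- Q) :+ T) :+ Q := A :+ T) refl

    reversed : ∀ j j′ → σ j Fin.≤ σ j′ → N j′ ℤ.≤ N j
    reversed j j′ σj≤σj′ = /[1+]-cancel-≤ K (subst₂ ℚ._≤_ (sym (N-position j′)) (sym (N-position j))
      (ℚP.+-monoˡ-≤ t (InA∅-antitone a∈A∅ σj≤σj′)))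

    shifted-width : ∀ j j′ → (N j ℤ.- + n) /[1+ K ] ℚ.≤ N j′ /[1+ K ]
    shifted-width j j′ = begin
      (N j ℤ.- + n) /[1+ K ]  ≡⟨ /[1+]-minus-one K (N j) ⟨
      N j /[1+ K ] ℚ.- 1ℚ     ≡⟨ cong (ℚ._- 1ℚ) (N-position j) ⟩
      (a (σ j) ℚ.+ t) ℚ.- 1ℚ  ≡⟨ swap (a (σ j)) t ⟩
      (a (σ j) ℚ.- 1ℚ) ℚ.+ t  ≤⟨ ℚP.+-monoˡ-≤ t (InA∅-width a∈A∅ (σ j) (σ j′)) ⟩
      a (σ j′) ℚ.+ t          ≡⟨ N-position j′ ⟨
      N j′ /[1+ K ]           ∎
      where
      open ℚP.≤-Reasoning
      open +-*-Solver
      swap : ∀ A T → (A ℚ.+ T) ℚ.- 1ℚ ≡ (A ℚ.- 1ℚ) ℚ.+ T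
      swap = solve 2 (λ A T → (A :+ T) :- con 1ℚ := (A :- con 1ℚ) :+ T) refl

    narrow : ∀ j j′ → N j ℤ.≤ N j′ ℤ.+ + n
    narrow j j′ = begin
      N j                    ≡⟨ split (N j) (+ n) ⟩
      (N j ℤ.- + n) ℤ.+ + n  ≤⟨ ℤP.+-monoˡ-≤ (+ n) (/[1+]-cancel-≤ K {N j ℤ.- + n} {N j′} (shifted-width j j′)) ⟩
      N j′ ℤ.+ + n           ∎
      where
      open ℤP.≤-Reasoning
      split : ∀ x y → x ≡ (x ℤ.- y) ℤ.+ y
      split = solve-∀

    sum≡c : ℤΣ.sum m ≡ + c
    sum≡c = begin
      ℤΣ.sum m               ≡⟨ ℤΣ.∑-distrib-+ g q ⟩
      ℤΣ.sum g ℤ.+ ℤΣ.sum q  ≡⟨ cong₂ ℤ._+_ (trans (sum-indicatorℤ γ) (cong +_ |γ|≡c)) (windings-sum-to-zero ws) ⟩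
      + c ℤ.+ 0ℤ             ≡⟨ ℤP.+-identityʳ (+ c) ⟩
      + c                    ∎
      where open ≡-Reasoning

    window-entry : ∀ j → lookup (wordW K ws) j ≡ (1ℤ ℤ.+ + (toℕ j ℕ.+ c)) ℤ.- + n ℤ.* g j
    window-entry j = begin
      lookup (wordW K ws) j                              ≡⟨ one-plus (lookup (wordW K ws) j) ⟩
      1ℤ ℤ.+ (lookup (wordW K ws) j ℤ.- 1ℤ)              ≡⟨ cong (λ y → 1ℤ ℤ.+ y) (residue-winding K (lookup (wordW K ws) j)) ⟩
      1ℤ ℤ.+ (+ toℕ (σ j) ℤ.+ q j ℤ.* + n)               ≡⟨ rearrange (+ toℕ (σ j)) (+ n) (g j) (q j) ⟩
      (1ℤ ℤ.+ (+ toℕ (σ j) ℤ.+ + n ℤ.* m j)) ℤ.- + n ℤ.* g j ≡⟨ cong (λ y → (1ℤ ℤ.+ y) ℤ.- + n ℤ.* g j) (rigidity sum≡c reversed narrow j) ⟩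
      (1ℤ ℤ.+ + (toℕ j ℕ.+ c)) ℤ.- + n ℤ.* g j           ∎
      where
      open ≡-Reasoning
      one-plus : ∀ x → x ≡ 1ℤ ℤ.+ (x ℤ.- 1ℤ)
      one-plus = solve-∀
      rearrange : ∀ s n g q → 1ℤ ℤ.+ (s ℤ.+ q ℤ.* n) ≡ (1ℤ ℤ.+ (s ℤ.+ n ℤ.* (g ℤ.+ q))) ℤ.- n ℤ.* g
      rearrange = solve-∀

    wordW≡jB : wordW K ws ≡ jB K c r γ
    wordW≡jB = trans (sym (VecP.tabulate∘lookup (wordW K ws)))
                     (VecP.tabulate-cong (λ j → trans (window-entry j) (jB-entry (toℕ j) (lookup γ j))))
      where
      jB-entry : ∀ i b → (1ℤ ℤ.+ + (i ℕ.+ c)) ℤ.- + n ℤ.* (if b then 1ℤ else 0ℤ)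
                         ≡ (if b then + suc i ℤ.- + r else + (suc i ℕ.+ c))
      jB-entry i true = begin
        (1ℤ ℤ.+ + (i ℕ.+ c)) ℤ.- + n ℤ.* 1ℤ            ≡⟨ cong₂ (λ x y → (1ℤ ℤ.+ x) ℤ.- y ℤ.* 1ℤ) (ℤP.pos-+ i c)
                                                            (trans (cong +_ (sym c+r≡n)) (ℤP.pos-+ c r)) ⟩
        (1ℤ ℤ.+ (+ i ℤ.+ + c)) ℤ.- (+ c ℤ.+ + r) ℤ.* 1ℤ ≡⟨ cancel (+ i) (+ c) (+ r) ⟩
        (1ℤ ℤ.+ + i) ℤ.- + r                          ≡⟨ cong (ℤ._- + r) (ℤP.pos-+ 1 i) ⟨
        + suc i ℤ.- + r                               ∎
        where
        open ≡-Reasoning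
        cancel : ∀ i c r → (1ℤ ℤ.+ (i ℤ.+ c)) ℤ.- (c ℤ.+ r) ℤ.* 1ℤ ≡ (1ℤ ℤ.+ i) ℤ.- r
        cancel = solve-∀
      jB-entry i false = trans (drop (1ℤ ℤ.+ + (i ℕ.+ c)) (+ n)) (sym (ℤP.pos-+ 1 (i ℕ.+ c)))
        where
        drop : ∀ x y → x ℤ.- y ℤ.* 0ℤ ≡ x
        drop = solve-∀

  window≡jB : w ≡ jB K c r γ
  window≡jB with alcove
  ... | ws , wordW≡w , a , a∈A∅ , t , x≈ = trans (sym wordW≡w) (wordW≡jB ws a a∈A∅ t x≈)

theorem3p18 : (k c r : ℕ) → 1 ≤ k → 1 ≤ c → 1 ≤ r → c + r ≡ suc k →
    (z : Subset (suc k) → Window k) →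
    (∀ γ → ∣ γ ∣ ≡ c → AlcoveIsShift k (z γ) (indicator γ)) →
    Y_R k c z ≡𝔸 W_R k c r
theorem3p18 (suc k′) c r _ _ r≥1 c+r≡n z A≡A∅+γ w = cong (λ ws → coeff ws w) (ListP.map-cong-local z≡jB-on-Γ)
  where
  z≡jB : ∀ {γ} → ∣ γ ∣ ≡ c → z γ ≡ jB (suc k′) c r γ
  z≡jB {γ} |γ|≡c = TranslatedAlcove.window≡jB k′ c r r≥1 c+r≡n γ |γ|≡c (z γ) (A≡A∅+γ γ |γ|≡c)
  z≡jB-on-Γ : All.All (λ γ → z γ ≡ jB (suc k′) c r γ) (subsetsOfSize (suc (suc k′)) c)
  z≡jB-on-Γ = All.map z≡jB (AllP.all-filter (λ B → ∣ B ∣ ℕ.≟ c) (allSubsets _))
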